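{- Let $\mathbf P=(P,\leq,{}',0,1)$ be a bounded poset with a unary operation $'$ and let $(P,\sqcup,{}',0,1)$ be an algebra assigned to $\mathbf P$. Then $\mathbf P$ is a generalized orthomodular poset if and only if the following conditions hold for all $x,y,z\in P$: (i) if $(x\sqcup z)\sqcup(((x'\sqcap w)\sqcap((x\sqcup y)\sqcap w))\sqcup z)=z$ for all $w\in P$, then $(x\sqcup y)\sqcup z=z$; (ii) $(x\sqcap y)\sqcup x=x$; (iii) $(x\sqcup y)\sqcup(x'\sqcup y)=1$; (iv) $x''=x$.
   Context: For a poset $(P,\leq)$ and $A\subseteq P$, $L(A)=\{x\mid x\leq a\ \forall a\in A\}$, $U(A)=\{x\mid a\leq x\ \forall a\in A\}$, $L(a,b)=L(\{a,b\})$, $U(a,B)=U(\{a\}\cup B)$, etc. An orthoposet is a bounded poset $(P,\leq,{}',0,1)$ with an antitone involution $'$ ($x''=x$, and $x\leq y\Rightarrow y'\leq x'$) such that $L(x,x')=\{0\}$ and $U(x,x')=\{1\}$ for all $x$. A generalized orthomodular poset is an orthoposet such that $x\leq y$ implies $U(y)=U(x,L(x',y))$. An algebra $(P,\sqcup,{}',0,1)$ of type $(2,1,0,0)$ is assigned to the bounded poset $(P,\leq,{}',0,1)$ (same $'$, $0$, $1$) if for all $x,y\in P$: $x\sqcup y=y$ whenever $x\leq y$, and $x\sqcup y=y\sqcup x\in U(x,y)$. Here $x\sqcap y$ abbreviates $(x'\sqcup y')'$. -}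

module Defs where

open import Level using (Level; _⊔_; suc)
open import Data.Product using (_×_)
open import Function.Bundles using (_⇔_)
open import Relation.Binary.PropositionalEquality using (_≡_)
open import Relation.Binary.Structures using (IsPartialOrder)

record BoundedPosetOp (a ℓ : Level) : Set (suc (a ⊔ ℓ)) where
  field
    Carrier        : Set a
    _≤_            : Carrier → Carrier → Set ℓ
    isPartialOrder : IsPartialOrder _≡_ _≤_
    _′             : Carrier → Carrier
    𝟎              : Carrier
    𝟏              : Carrier
    𝟎-least        : ∀ x → 𝟎 ≤ x
    𝟏-greatest     : ∀ x → x ≤ 𝟏
  infix 4 _≤_
  infix 10 _′

module _ {a ℓ : Level} (P : BoundedPosetOp a ℓ) where
  open BoundedPosetOp P

  -- Subsets of P are predicates; L and U of the relevant sets, as membership predicates.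
  -- t ∈ L(x, y)
  L₂ : Carrier → Carrier → Carrier → Set ℓ
  L₂ x y t = t ≤ x × t ≤ y
  U₂ : Carrier → Carrier → Carrier → Set ℓ
  U₂ x y t = x ≤ t × y ≤ t
  U₁ : Carrier → Carrier → Set ℓ
  U₁ y t = y ≤ t
  -- t ∈ U(x, L(x′, y)) = U({x} ∪ L(x′, y))
  U-x-L : Carrier → Carrier → Carrier → Set (a ⊔ ℓ)
  U-x-L x y t = x ≤ t × (∀ s → L₂ (x ′) y s → s ≤ t)

  record IsOrthoposet : Set (a ⊔ ℓ) where
    field
      involutive : ∀ x → x ′ ′ ≡ x
      antitone   : ∀ {x y} → x ≤ y → y ′ ≤ x ′
      L-compl    : ∀ x t → (L₂ x (x ′) t ⇔ t ≡ 𝟎)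
      U-compl    : ∀ x t → (U₂ x (x ′) t ⇔ t ≡ 𝟏)

  record IsGOMP : Set (a ⊔ ℓ) where
    field
      isOrthoposet : IsOrthoposet
      gom          : ∀ {x y} → x ≤ y → ∀ t → (U₁ y t ⇔ U-x-L x y t)

  record IsAssigned (_⊔′_ : Carrier → Carrier → Carrier) : Set (a ⊔ ℓ) where
    field
      ⊔-≤    : ∀ {x y} → x ≤ y → x ⊔′ y ≡ y
      ⊔-comm : ∀ x y → x ⊔′ y ≡ y ⊔′ x
      ⊔-ub₁  : ∀ x y → x ≤ x ⊔′ y
      ⊔-ub₂  : ∀ x y → y ≤ x ⊔′ y

  module _ (_⊔′_ : Carrier → Carrier → Carrier) where
    _⊓′_ : Carrier → Carrier → Carrier
    x ⊓′ y = ((x ′) ⊔′ (y ′)) ′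

    record Conditions : Set a where
      field
        cond-i   : ∀ x y z →
                   (∀ w → ((x ⊔′ z) ⊔′ ((((x ′) ⊓′ w) ⊓′ ((x ⊔′ y) ⊓′ w)) ⊔′ z)) ≡ z) →
                   (x ⊔′ y) ⊔′ z ≡ z
        cond-ii  : ∀ x y → (x ⊓′ y) ⊔′ x ≡ x
        cond-iii : ∀ x y → (x ⊔′ y) ⊔′ ((x ′) ⊔′ y) ≡ 𝟏
        cond-iv  : ∀ x → x ′ ′ ≡ x

-- Under an antitone involution, the element ((x′ ⊓ w) ⊓ ((x ⊔ y) ⊓ w)) always lies in
-- L(x′, x ⊔ y) and equals w whenever w does; so the premise of (i) says precisely that z is
-- an upper bound of {x} ∪ L(x′, x ⊔ y), and (i) becomes the orthomodular law for x ≤ x ⊔ y.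
-- Conditions (ii)–(iv) make ′ an antitone involution, and (iii) turns every common upper
-- bound of x and x′ into 1, which by duality also settles L(x, x′) = {0}.
module Submission where

open import Defs
open import Level using (Level)
open import Function.Bundles using (_⇔_; mk⇔; Equivalence)
open import Relation.Binary.PropositionalEquality using (_≡_; refl; subst; cong; cong₂; sym; trans; module ≡-Reasoning)
open import Relation.Binary.Structures using (IsPartialOrder)
open import Data.Product using (_×_; _,_; proj₁; proj₂)

module AssignedAlgebra {a ℓ : Level} (P : BoundedPosetOp a ℓ)
    (_⊔_ : BoundedPosetOp.Carrier P → BoundedPosetOp.Carrier P → BoundedPosetOp.Carrier P)
    (assigned : IsAssigned P _⊔_) where
  open BoundedPosetOp P
  open IsAssigned assigned
  open IsPartialOrder isPartialOrder using (antisym) renaming (refl to ≤-refl; trans to ≤-trans)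

  _⊓_ : Carrier → Carrier → Carrier
  _⊓_ = _⊓′_ P _⊔_

  ⊔-idem : ∀ x → x ⊔ x ≡ x
  ⊔-idem x = ⊔-≤ ≤-refl

  ⊔≡⇒ub : ∀ {x y z} → x ⊔ y ≡ z → x ≤ z × y ≤ z
  ⊔≡⇒ub {x} {y} e = subst (x ≤_) e (⊔-ub₁ x y) , subst (y ≤_) e (⊔-ub₂ x y)

  ⊔≡⇒≤ : ∀ {x y} → x ⊔ y ≡ y → x ≤ y
  ⊔≡⇒≤ e = proj₁ (⊔≡⇒ub e)

  ⊔-ub-ub : ∀ {x y z} → x ≤ z → y ≤ z → (x ⊔ z) ⊔ (y ⊔ z) ≡ z
  ⊔-ub-ub {z = z} x≤z y≤z = trans (cong₂ _⊔_ (⊔-≤ x≤z) (⊔-≤ y≤z)) (⊔-idem z)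

  U₁⇒U-x-L : ∀ {x y t} → x ≤ y → U₁ P y t → U-x-L P x y t
  U₁⇒U-x-L x≤y y≤t = ≤-trans x≤y y≤t , λ _ s∈L → ≤-trans (proj₂ s∈L) y≤t

  module AntitoneInvolution (involutive : ∀ x → x ′ ′ ≡ x)
      (antitone : ∀ {x y} → x ≤ y → y ′ ≤ x ′) where

    𝟏′≡𝟎 : 𝟏 ′ ≡ 𝟎
    𝟏′≡𝟎 = antisym (subst (𝟏 ′ ≤_) (involutive 𝟎) (antitone (𝟏-greatest (𝟎 ′)))) (𝟎-least (𝟏 ′))

    ⊓-lowerˡ : ∀ x y → x ⊓ y ≤ x
    ⊓-lowerˡ x y = subst (x ⊓ y ≤_) (involutive x) (antitone (⊔-ub₁ (x ′) (y ′)))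

    ⊓-lowerʳ : ∀ x y → x ⊓ y ≤ y
    ⊓-lowerʳ x y = subst (_≤ y) (cong _′ (⊔-comm (y ′) (x ′))) (⊓-lowerˡ y x)

    ≤⇒⊓≡ : ∀ {s b} → s ≤ b → b ⊓ s ≡ s
    ≤⇒⊓≡ {s} s≤b = trans (cong _′ (⊔-≤ (antitone s≤b))) (involutive s)

    cond-i-witness : Carrier → Carrier → Carrier → Carrier
    cond-i-witness x y w = ((x ′) ⊓ w) ⊓ ((x ⊔ y) ⊓ w)

    cond-i-witness-lower : ∀ x y w → L₂ P (x ′) (x ⊔ y) (cond-i-witness x y w)
    cond-i-witness-lower x y w =
        ≤-trans (⊓-lowerˡ _ _) (⊓-lowerˡ (x ′) w)
      , ≤-trans (⊓-lowerʳ _ _) (⊓-lowerˡ (x ⊔ y) w)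

    cond-i-witness-fixes : ∀ {x y s} → L₂ P (x ′) (x ⊔ y) s → cond-i-witness x y s ≡ s
    cond-i-witness-fixes (s≤x′ , s≤x⊔y) =
      trans (cong₂ _⊓_ (≤⇒⊓≡ s≤x′) (≤⇒⊓≡ s≤x⊔y)) (≤⇒⊓≡ ≤-refl)

    cond-i-premise⇔U-x-L : ∀ x y z →
      (∀ w → (x ⊔ z) ⊔ (cond-i-witness x y w ⊔ z) ≡ z) ⇔ U-x-L P x (x ⊔ y) z
    cond-i-premise⇔U-x-L x y z = mk⇔ to from
      where
      to : (∀ w → (x ⊔ z) ⊔ (cond-i-witness x y w ⊔ z) ≡ z) → U-x-L P x (x ⊔ y) z
      to h = ≤-trans (⊔-ub₁ x z) (proj₁ (⊔≡⇒ub (h 𝟎)))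
           , λ s s∈L → subst (_≤ z) (cond-i-witness-fixes s∈L)
                         (≤-trans (⊔-ub₁ _ z) (proj₂ (⊔≡⇒ub (h s))))
      from : U-x-L P x (x ⊔ y) z → ∀ w → (x ⊔ z) ⊔ (cond-i-witness x y w ⊔ z) ≡ z
      from (x≤z , L≤z) w = ⊔-ub-ub x≤z (L≤z _ (cond-i-witness-lower x y w))

  IsGOMP⇒Conditions : IsGOMP P → Conditions P _⊔_
  IsGOMP⇒Conditions gomp = record
    { cond-i   = λ x y z premise →
        ⊔-≤ (Equivalence.from (gom (⊔-ub₁ x y) z)
               (Equivalence.to (cond-i-premise⇔U-x-L x y z) premise))
    ; cond-ii  = λ x y → ⊔-≤ (⊓-lowerˡ x y)
    ; cond-iii = λ x y → Equivalence.to (U-compl x _)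
        (≤-trans (⊔-ub₁ x y) (⊔-ub₁ _ _) , ≤-trans (⊔-ub₁ (x ′) y) (⊔-ub₂ _ _))
    ; cond-iv  = involutive
    }
    where
    open IsGOMP gomp
    open IsOrthoposet isOrthoposet
    open AntitoneInvolution involutive antitone

  Conditions⇒IsGOMP : Conditions P _⊔_ → IsGOMP P
  Conditions⇒IsGOMP conditions = record
    { isOrthoposet = record
      { involutive = cond-iv
      ; antitone   = antitone
      ; L-compl    = λ x t → mk⇔ (λ (t≤x , t≤x′) → L-bound⇒𝟎 t≤x t≤x′)
                                  λ { refl → 𝟎-least x , 𝟎-least (x ′) }
      ; U-compl    = λ x t → mk⇔ (λ (x≤t , x′≤t) → U-bound⇒𝟏 x≤t x′≤t)
                                  λ { refl → 𝟏-greatest x , 𝟏-greatest (x ′) }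
      }
    ; gom = λ x≤y t → mk⇔ (U₁⇒U-x-L x≤y) (U-x-L⇒U₁ x≤y)
    }
    where
    open Conditions conditions

    antitone : ∀ {x y} → x ≤ y → y ′ ≤ x ′
    antitone {x} {y} x≤y = subst (_≤ x ′) (cong _′ x′′⊔y′′≡y) (⊔≡⇒≤ (cond-ii (x ′) (y ′)))
      where
      open ≡-Reasoning
      x′′⊔y′′≡y : (x ′ ′) ⊔ (y ′ ′) ≡ y
      x′′⊔y′′≡y = begin
        (x ′ ′) ⊔ (y ′ ′) ≡⟨ cong₂ _⊔_ (cond-iv x) (cond-iv y) ⟩
        x ⊔ y             ≡⟨ ⊔-≤ x≤y ⟩
        y                 ∎

    open AntitoneInvolution cond-iv antitone

    U-bound⇒𝟏 : ∀ {x t} → x ≤ t → x ′ ≤ t → t ≡ 𝟏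
    U-bound⇒𝟏 {x} {t} x≤t x′≤t = trans (sym (⊔-ub-ub x≤t x′≤t)) (cond-iii x t)

    L-bound⇒𝟎 : ∀ {x t} → t ≤ x → t ≤ x ′ → t ≡ 𝟎
    L-bound⇒𝟎 {x} {t} t≤x t≤x′ = begin
      t         ≡⟨ sym (cond-iv t) ⟩
      t ′ ′     ≡⟨ cong _′ (U-bound⇒𝟏 (antitone t≤x) (antitone t≤x′)) ⟩
      𝟏 ′       ≡⟨ 𝟏′≡𝟎 ⟩
      𝟎         ∎
      where open ≡-Reasoning

    U-x-L⇒U₁ : ∀ {x y t} → x ≤ y → U-x-L P x y t → U₁ P y t
    U-x-L⇒U₁ {x} {y} {t} x≤y t∈U =
      subst (_≤ t) (⊔-≤ x≤y)
        (⊔≡⇒≤ (cond-i x y t (Equivalence.from (cond-i-premise⇔U-x-L x y t) t∈U′)))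
      where
      t∈U′ : U-x-L P x (x ⊔ y) t
      t∈U′ = subst (λ u → U-x-L P x u t) (sym (⊔-≤ x≤y)) t∈U

mainTheorem5 : ∀ {a ℓ : Level} (P : BoundedPosetOp a ℓ)
                 (_⊔′_ : BoundedPosetOp.Carrier P → BoundedPosetOp.Carrier P → BoundedPosetOp.Carrier P) →
                 IsAssigned P _⊔′_ →
                 (IsGOMP P ⇔ Conditions P _⊔′_)
mainTheorem5 P _⊔′_ assigned = mk⇔ IsGOMP⇒Conditions Conditions⇒IsGOMP
  where open AssignedAlgebra P _⊔′_ assigned
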